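{- Let $T$ be a perfect $k$-ary tree with $k \geq 2$ and height at least $1$, and let $f$ be an independent broadcast on $T$ of maximum weight. Then every leaf of $T$ hears some broadcasting vertex that is a leaf of $T$.
   Context: For a graph $G$, $d(u,v)$ is the distance, $\mathrm{ecc}(v)$ the eccentricity, $\mathrm{diam}(G)$ the diameter. A broadcast on $G$ is a function $f: V(G)\to\{0,\dots,\mathrm{diam}(G)\}$ with $f(v)\le\mathrm{ecc}(v)$; its weight is $\sum_v f(v)$. A vertex $v$ is broadcasting if $f(v)>0$; $u$ hears a broadcasting $v$ if $d(u,v)\le f(v)$ (a broadcasting vertex hears itself). A broadcast is independent if every broadcasting vertex hears only itself. A perfect $k$-ary tree of height $h$ is the rooted tree in which every non-leaf vertex has exactly $k$ children and all leaves are at distance $h$ from the root. -}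

module Defs where

open import Data.Nat using (ℕ; zero; suc; _+_; _≤_; _<_; _⊔_; z≤n; s≤s)
open import Data.Fin using (Fin)
open import Data.Fin.Properties using (_≟_)
open import Data.List using (List; []; _∷_; length; map; concatMap; allFin; foldr)
open import Data.Product using (Σ; _,_; proj₁; proj₂; _×_; ∃)
open import Relation.Nullary using (yes; no; ¬_)
open import Relation.Binary.PropositionalEquality using (_≡_; _≢_)

-- A vertex is the path from the root,
-- i.e. a list of child indices (each in Fin k) of length at most h.
-- Lists are read root-first: the vertex  p ++ [i]  is the i-th child of p.
Vertex : ℕ → ℕ → Set
Vertex k h = Σ (List (Fin k)) (λ p → length p ≤ h)

depth : ∀ {k h} → Vertex k h → ℕ
depth (p , _) = length p

IsLeaf : ∀ {k h} → Vertex k h → Set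
IsLeaf {h = h} v = depth v ≡ h

allVertices : (k h : ℕ) → List (Vertex k h)
allVertices k zero = ([] , z≤n) ∷ []
allVertices k (suc h) =
  ([] , z≤n) ∷ concatMap (λ i → map (λ v → (i ∷ proj₁ v , s≤s (proj₂ v))) (allVertices k h)) (allFin k)

-- graph distance in the tree between root-paths p and q:
-- walk up to the lowest common ancestor and down again.
pathDist : ∀ {k} → List (Fin k) → List (Fin k) → ℕ
pathDist [] q = length q
pathDist (a ∷ p) [] = suc (length p)
pathDist (a ∷ p) (b ∷ q) with a ≟ b
... | yes _ = pathDist p q
... | no _ = suc (length p) + suc (length q)

dist : ∀ {k h} → Vertex k h → Vertex k h → ℕ
dist u v = pathDist (proj₁ u) (proj₁ v)

maxList : List ℕ → ℕ
maxList = foldr _⊔_ 0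

ecc : ∀ {k h} → Vertex k h → ℕ
ecc {k} {h} v = maxList (map (λ u → dist u v) (allVertices k h))

diam : ℕ → ℕ → ℕ
diam k h = maxList (map ecc (allVertices k h))

IsBroadcast : ∀ {k h} → (Vertex k h → ℕ) → Set
IsBroadcast {k} {h} f = ∀ v → (f v ≤ diam k h) × (f v ≤ ecc v)

weight : ∀ {k h} → (Vertex k h → ℕ) → ℕ
weight {k} {h} f = foldr (λ v acc → f v + acc) 0 (allVertices k h)

Broadcasting : ∀ {k h} → (Vertex k h → ℕ) → Vertex k h → Set
Broadcasting f v = 0 < f v

Hears : ∀ {k h} → (Vertex k h → ℕ) → Vertex k h → Vertex k h → Set
Hears f u v = Broadcasting f v × dist u v ≤ f v

IsIndependent : ∀ {k h} → (Vertex k h → ℕ) → Set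
IsIndependent f = ∀ v w → Broadcasting f v → Hears f v w → v ≡ w

IsIndepBroadcast : ∀ {k h} → (Vertex k h → ℕ) → Set
IsIndepBroadcast f = IsBroadcast f × IsIndependent f

IsMaxIndepBroadcast : ∀ {k h} → (Vertex k h → ℕ) → Set
IsMaxIndepBroadcast {k} {h} f =
  IsIndepBroadcast f × (∀ (g : Vertex k h → ℕ) → IsIndepBroadcast g → weight g ≤ weight f)

-- Both steps are exchange arguments against maximality. A leaf u that hears no broadcast could
-- itself broadcast with strength 1. If u hears a non-leaf v, move the broadcast of v to a leaf w
-- below v, raising its strength by t = dist w v. As u is a leaf, t ≤ dist u v ≤ f v, so no other
-- broadcaster lies in the subtree of v (it would hear v); hence every other broadcaster is t
-- further from w than from v and independence survives. Since k ≥ 2, ecc w = 2h leaves room for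
-- the stronger broadcast, and the weight grows by t > 0.
module Submission where

open import Defs
open import Data.Nat using (ℕ; zero; suc; _+_; _∸_; _≤_; _<_; z≤n; s≤s)
open import Data.Nat.Properties hiding (suc-injective)
open import Algebra.Properties.CommutativeSemigroup +-commutativeSemigroup using (interchange)
open import Data.Fin using (Fin; zero; suc; punchIn; fromℕ<)
open import Data.Fin.Properties using (punchInᵢ≢i; suc-injective) renaming (_≟_ to _≟ᶠ_)
open import Data.List using (List; []; _∷_; length; map; concatMap; allFin; foldr; _++_; replicate)
open import Data.List.Properties using (length-++; length-replicate; ∷-injectiveˡ; map-tabulate)
import Data.List.Properties as List
open import Data.List.Membership.Propositional using (_∈_)
open import Data.List.Relation.Unary.Any as Any using (here; there; any?)
open import Data.Product using (Σ; _,_; proj₁; proj₂; _×_)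
import Data.Product.Properties as Product
open import Data.Sum using (_⊎_; inj₁; inj₂)
open import Function using (_∘_)
open import Relation.Nullary using (yes; no; ¬_; contradiction)
open import Relation.Nullary.Decidable using (_×-dec_)
open import Relation.Binary.Definitions using (DecidableEquality)
open import Relation.Binary.PropositionalEquality

sumOver : {A : Set} → List A → (A → ℕ) → ℕ
sumOver L φ = foldr (λ x acc → φ x + acc) 0 L

module _ {A : Set} where

  sumOver-cong : (L : List A) {φ ψ : A → ℕ} → (∀ x → φ x ≡ ψ x) → sumOver L φ ≡ sumOver L ψ
  sumOver-cong []      eq = refl
  sumOver-cong (x ∷ L) eq = cong₂ _+_ (eq x) (sumOver-cong L eq)

  sumOver-zero : (L : List A) (φ : A → ℕ) → (∀ x → φ x ≡ 0) → sumOver L φ ≡ 0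
  sumOver-zero []      φ eq = refl
  sumOver-zero (x ∷ L) φ eq = cong₂ _+_ (eq x) (sumOver-zero L φ eq)

  sumOver-+ : (L : List A) (φ ψ : A → ℕ) → sumOver L (λ x → φ x + ψ x) ≡ sumOver L φ + sumOver L ψ
  sumOver-+ []      φ ψ = refl
  sumOver-+ (x ∷ L) φ ψ =
    trans (cong (φ x + ψ x +_) (sumOver-+ L φ ψ)) (interchange (φ x) (ψ x) (sumOver L φ) (sumOver L ψ))

  sumOver-++ : (xs ys : List A) (φ : A → ℕ) → sumOver (xs ++ ys) φ ≡ sumOver xs φ + sumOver ys φ
  sumOver-++ []       ys φ = refl
  sumOver-++ (x ∷ xs) ys φ = trans (cong (φ x +_) (sumOver-++ xs ys φ)) (sym (+-assoc (φ x) _ _))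

  module _ {B : Set} where

    sumOver-map : (m : B → A) (xs : List B) (φ : A → ℕ) → sumOver (map m xs) φ ≡ sumOver xs (φ ∘ m)
    sumOver-map m []       φ = refl
    sumOver-map m (x ∷ xs) φ = cong (φ (m x) +_) (sumOver-map m xs φ)

    sumOver-concatMap : (g : B → List A) (xs : List B) (φ : A → ℕ) →
                        sumOver (concatMap g xs) φ ≡ sumOver xs (λ b → sumOver (g b) φ)
    sumOver-concatMap g []       φ = refl
    sumOver-concatMap g (x ∷ xs) φ =
      trans (sumOver-++ (g x) (concatMap g xs) φ) (cong (sumOver (g x) φ +_) (sumOver-concatMap g xs φ))

sumOver-allFin-suc : ∀ {n} (φ : Fin (suc n) → ℕ) →
                     sumOver (allFin (suc n)) φ ≡ φ zero + sumOver (allFin n) (φ ∘ suc)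
sumOver-allFin-suc {n} φ = cong (φ zero +_) (trans
  (cong (λ L → sumOver L φ) (sym (map-tabulate (λ i → i) suc)))
  (sumOver-map suc (allFin n) φ))

sumOver-allFin-single : ∀ {n} (φ : Fin n → ℕ) (i : Fin n) → (∀ j → j ≢ i → φ j ≡ 0) →
                        sumOver (allFin n) φ ≡ φ i
sumOver-allFin-single {suc n} φ zero    off = begin
  sumOver (allFin (suc n)) φ              ≡⟨ sumOver-allFin-suc φ ⟩
  φ zero + sumOver (allFin n) (φ ∘ suc)   ≡⟨ cong (φ zero +_) (sumOver-zero (allFin n) (φ ∘ suc) λ j → off (suc j) λ ()) ⟩
  φ zero + 0                              ≡⟨ +-identityʳ (φ zero) ⟩
  φ zero                                  ∎
  where open ≡-Reasoning
sumOver-allFin-single {suc n} φ (suc i) off = begin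
  sumOver (allFin (suc n)) φ              ≡⟨ sumOver-allFin-suc φ ⟩
  φ zero + sumOver (allFin n) (φ ∘ suc)   ≡⟨ cong₂ _+_ (off zero λ ())
                                               (sumOver-allFin-single (φ ∘ suc) i λ j j≢i → off (suc j) (j≢i ∘ suc-injective)) ⟩
  φ (suc i)                               ∎
  where open ≡-Reasoning

module _ {k : ℕ} where

  root : ∀ {h} → Vertex k h
  root = [] , z≤n

  intoSubtree : ∀ {h} → Fin k → Vertex k h → Vertex k (suc h)
  intoSubtree i (p , p≤h) = i ∷ p , s≤s p≤h

  vertex-≡ : ∀ {h} {u v : Vertex k h} → proj₁ u ≡ proj₁ v → u ≡ v
  vertex-≡ {u = p , _} {v = .p , _} refl = cong (p ,_) (≤-irrelevant _ _)

  _≟ᵥ_ : ∀ {h} → DecidableEquality (Vertex k h)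
  _≟ᵥ_ = Product.≡-dec (List.≡-dec _≟ᶠ_) (λ p q → yes (≤-irrelevant p q))

  module _ {h : ℕ} where

    point : Vertex k h → ℕ → Vertex k h → ℕ
    point v c y with y ≟ᵥ v
    ... | yes _ = c
    ... | no  _ = 0

    point-self : ∀ v c → point v c v ≡ c
    point-self v c with v ≟ᵥ v
    ... | yes _   = refl
    ... | no  v≢v = contradiction refl v≢v

    point-other : ∀ {v y} c → y ≢ v → point v c y ≡ 0
    point-other {v} {y} c y≢v with y ≟ᵥ v
    ... | yes y≡v = contradiction y≡v y≢v
    ... | no  _   = refl

    _[_≔_] : (Vertex k h → ℕ) → Vertex k h → ℕ → Vertex k h → ℕ
    (f [ v ≔ c ]) y with y ≟ᵥ v
    ... | yes _ = c
    ... | no  _ = f y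

    update-other : ∀ f {v y} c → y ≢ v → (f [ v ≔ c ]) y ≡ f y
    update-other f {v} {y} c y≢v with y ≟ᵥ v
    ... | yes y≡v = contradiction y≡v y≢v
    ... | no  _   = refl

    update+point : ∀ f v c y → (f [ v ≔ c ]) y + point v (f v) y ≡ f y + point v c y
    update+point f v c y with y ≟ᵥ v
    ... | yes refl = +-comm c (f y)
    ... | no  _    = refl

  point-intoSubtree : ∀ {h} i (v y : Vertex k h) c → point (intoSubtree i v) c (intoSubtree i y) ≡ point v c y
  point-intoSubtree i v y c with y ≟ᵥ v
  ... | yes refl = point-self (intoSubtree i v) c
  ... | no  y≢v  = point-other c (λ eq → y≢v (vertex-≡ (List.∷-injectiveʳ (cong proj₁ eq))))

  sumOver-allVertices-suc : ∀ {h} (φ : Vertex k (suc h) → ℕ) →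
    sumOver (allVertices k (suc h)) φ ≡
    φ root + sumOver (allFin k) (λ i → sumOver (allVertices k h) (φ ∘ intoSubtree i))
  sumOver-allVertices-suc {h} φ = cong (φ root +_) (begin
    sumOver (concatMap (λ i → map (intoSubtree i) (allVertices k h)) (allFin k)) φ
      ≡⟨ sumOver-concatMap (λ i → map (intoSubtree i) (allVertices k h)) (allFin k) φ ⟩
    sumOver (allFin k) (λ i → sumOver (map (intoSubtree i) (allVertices k h)) φ)
      ≡⟨ sumOver-cong (allFin k) (λ i → sumOver-map (intoSubtree i) (allVertices k h) φ) ⟩
    sumOver (allFin k) (λ i → sumOver (allVertices k h) (φ ∘ intoSubtree i)) ∎)
    where open ≡-Reasoning

  -- allVertices lists every vertex exactly once; in this form the fact yields both the
  -- completeness of the enumeration and the weight change caused by a point update.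
  sumOver-point : ∀ {h} (v : Vertex k h) c → sumOver (allVertices k h) (point v c) ≡ c
  sumOver-point {zero} ([] , z≤n) c = trans (+-identityʳ c) (point-self {zero} root c)
  sumOver-point {suc h} ([] , z≤n) c = begin
    sumOver (allVertices k (suc h)) (point root c)
      ≡⟨ sumOver-allVertices-suc (point root c) ⟩
    point {suc h} root c root + sumOver (allFin k) (λ i → sumOver (allVertices k h) (point root c ∘ intoSubtree i))
      ≡⟨ cong₂ _+_ (point-self {suc h} root c) (sumOver-zero (allFin k) _ λ i →
           sumOver-zero (allVertices k h) _ λ y → point-other {v = root} {intoSubtree i y} c (λ ())) ⟩
    c + 0
      ≡⟨ +-identityʳ c ⟩
    c ∎
    where open ≡-Reasoning
  sumOver-point {suc h} (i ∷ p , s≤s p≤h) c = begin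
    sumOver (allVertices k (suc h)) (point v c)
      ≡⟨ sumOver-allVertices-suc (point v c) ⟩
    point v c root + sumOver (allFin k) (λ j → sumOver (allVertices k h) (point v c ∘ intoSubtree j))
      ≡⟨ cong₂ _+_ (point-other {v = v} {root} c λ ()) (sumOver-allFin-single _ i λ j j≢i →
           sumOver-zero (allVertices k h) _ λ y →
             point-other {v = v} {intoSubtree j y} c (j≢i ∘ ∷-injectiveˡ ∘ cong proj₁)) ⟩
    sumOver (allVertices k h) (point v c ∘ intoSubtree i)
      ≡⟨ sumOver-cong (allVertices k h) (λ y → point-intoSubtree i (p , p≤h) y c) ⟩
    sumOver (allVertices k h) (point (p , p≤h) c)
      ≡⟨ sumOver-point (p , p≤h) c ⟩
    c ∎
    where
    open ≡-Reasoning
    v : Vertex k (suc h)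
    v = i ∷ p , s≤s p≤h

  module _ {h : ℕ} where

    ∈-allVertices : (v : Vertex k h) → v ∈ allVertices k h
    ∈-allVertices v = found (allVertices k h) (subst (0 <_) (sym (sumOver-point v 1)) (s≤s z≤n))
      where
      found : (L : List (Vertex k h)) → 0 < sumOver L (point v 1) → v ∈ L
      found (x ∷ L) positive with v ≟ᵥ x
      ... | yes v≡x = here v≡x
      ... | no  v≢x =
        there (found L (subst (λ n → 0 < n + sumOver L (point v 1)) (point-other 1 (v≢x ∘ sym)) positive))

    weight-update : (f : Vertex k h → ℕ) (v : Vertex k h) (c : ℕ) → weight (f [ v ≔ c ]) + f v ≡ weight f + c
    weight-update f v c = begin
      weight (f [ v ≔ c ]) + f v
        ≡⟨ cong (weight (f [ v ≔ c ]) +_) (sym (sumOver-point v (f v))) ⟩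
      sumOver L (f [ v ≔ c ]) + sumOver L (point v (f v))
        ≡⟨ sym (sumOver-+ L (f [ v ≔ c ]) (point v (f v))) ⟩
      sumOver L (λ y → (f [ v ≔ c ]) y + point v (f v) y)
        ≡⟨ sumOver-cong L (update+point f v c) ⟩
      sumOver L (λ y → f y + point v c y)
        ≡⟨ sumOver-+ L f (point v c) ⟩
      weight f + sumOver L (point v c)
        ≡⟨ cong (weight f +_) (sumOver-point v c) ⟩
      weight f + c ∎
      where
      open ≡-Reasoning
      L : List (Vertex k h)
      L = allVertices k h

module _ {A : Set} (φ : A → ℕ) where

  ≤-maxList : ∀ {x L} → x ∈ L → φ x ≤ maxList (map φ L)
  ≤-maxList {L = y ∷ L} (here refl) = m≤m⊔n (φ y) _
  ≤-maxList {L = y ∷ L} (there x∈L) = ≤-trans (≤-maxList x∈L) (m≤n⊔m (φ y) _)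

  maxList-≤ : ∀ L {b} → (∀ x → φ x ≤ b) → maxList (map φ L) ≤ b
  maxList-≤ []      φ≤b = z≤n
  maxList-≤ (x ∷ L) φ≤b = ⊔-lub (φ≤b x) (maxList-≤ L φ≤b)

module _ {k : ℕ} where

  pathDist-self : (p : List (Fin k)) → pathDist p p ≡ 0
  pathDist-self []      = refl
  pathDist-self (a ∷ p) with a ≟ᶠ a
  ... | yes _   = pathDist-self p
  ... | no  a≢a = contradiction refl a≢a

  pathDist-sym : (p q : List (Fin k)) → pathDist p q ≡ pathDist q p
  pathDist-sym []      []      = refl
  pathDist-sym []      (b ∷ q) = refl
  pathDist-sym (a ∷ p) []      = refl
  pathDist-sym (a ∷ p) (b ∷ q) with a ≟ᶠ b | b ≟ᶠ a
  ... | yes _   | yes _   = pathDist-sym p q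
  ... | yes a≡b | no  b≢a = contradiction (sym a≡b) b≢a
  ... | no  a≢b | yes b≡a = contradiction (sym b≡a) a≢b
  ... | no  _   | no  _   = +-comm (suc (length p)) (suc (length q))

  pathDist-root : (p : List (Fin k)) → pathDist p [] ≡ length p
  pathDist-root []      = refl
  pathDist-root (a ∷ p) = refl

  pathDist-diverging : ∀ {a b} (p q : List (Fin k)) → a ≢ b →
                       pathDist (a ∷ p) (b ∷ q) ≡ suc (length p) + suc (length q)
  pathDist-diverging {a} {b} p q a≢b with a ≟ᶠ b
  ... | yes a≡b = contradiction a≡b a≢b
  ... | no  _   = refl

  length≤pathDist+length : (p q : List (Fin k)) → length p ≤ pathDist p q + length q
  length≤pathDist+length []      q       = z≤n
  length≤pathDist+length (a ∷ p) []      = ≤-reflexive (sym (+-identityʳ _))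
  length≤pathDist+length (a ∷ p) (b ∷ q) with a ≟ᶠ b
  ... | yes _ = ≤-trans (s≤s (length≤pathDist+length p q)) (≤-reflexive (sym (+-suc _ _)))
  ... | no  _ = ≤-trans (m≤m+n (suc (length p)) (suc (length q))) (m≤m+n _ (suc (length q)))

  pathDist≤length+length : (p q : List (Fin k)) → pathDist p q ≤ length p + length q
  pathDist≤length+length []      q       = ≤-refl
  pathDist≤length+length (a ∷ p) []      = ≤-reflexive (sym (+-identityʳ _))
  pathDist≤length+length (a ∷ p) (b ∷ q) with a ≟ᶠ b
  ... | yes _ = ≤-trans (pathDist≤length+length p q) (+-mono-≤ (n≤1+n _) (n≤1+n _))
  ... | no  _ = ≤-refl

  pathDist-extension : (p e : List (Fin k)) → pathDist (p ++ e) p ≡ length e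
  pathDist-extension []      e = pathDist-root e
  pathDist-extension (a ∷ p) e with a ≟ᶠ a
  ... | yes _   = pathDist-extension p e
  ... | no  a≢a = contradiction refl a≢a

  -- Either x lies below p, or every path from x to below p passes through p.
  descendant-or-pathDist-++ : (x p e : List (Fin k)) →
    (pathDist x p + length p ≡ length x) ⊎ (pathDist x (p ++ e) ≡ pathDist x p + length e)
  descendant-or-pathDist-++ []      []      e = inj₁ refl
  descendant-or-pathDist-++ (a ∷ x) []      e = inj₁ (+-identityʳ _)
  descendant-or-pathDist-++ []      (b ∷ p) e = inj₂ (cong suc (length-++ p))
  descendant-or-pathDist-++ (a ∷ x) (b ∷ p) e with a ≟ᶠ b
  ... | yes _ with descendant-or-pathDist-++ x p e
  ...   | inj₁ below = inj₁ (trans (+-suc _ _) (cong suc below))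
  ...   | inj₂ via   = inj₂ via
  descendant-or-pathDist-++ (a ∷ x) (b ∷ p) e | no _ rewrite length-++ p {e} =
    inj₂ (sym (+-assoc (suc (length x)) (suc (length p)) (length e)))

  module _ {h : ℕ} where

    dist≤ecc : (u v : Vertex k h) → dist u v ≤ ecc v
    dist≤ecc u v = ≤-maxList (λ y → dist y v) (∈-allVertices u)

    ecc≤diam : (v : Vertex k h) → ecc v ≤ diam k h
    ecc≤diam v = ≤-maxList ecc (∈-allVertices v)

    ecc≤height+depth : (v : Vertex k h) → ecc v ≤ h + depth v
    ecc≤height+depth v = maxList-≤ (λ y → dist y v) (allVertices k h)
      λ y → ≤-trans (pathDist≤length+length (proj₁ y) (proj₁ v)) (+-monoˡ-≤ (depth v) (proj₂ y))

height+depth≤ecc : ∀ {k h} → 2 ≤ k → (v : Vertex k h) → h + depth v ≤ ecc v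
height+depth≤ecc {suc zero} (s≤s ()) v
height+depth≤ecc {suc (suc _)} {h} _ v@([] , _) = begin
  h + 0                          ≡⟨ +-identityʳ h ⟩
  h                              ≡⟨ sym (length-replicate h) ⟩
  length (replicate h zero)      ≡⟨ sym (pathDist-root (replicate h zero)) ⟩
  dist leaf v                    ≤⟨ dist≤ecc leaf v ⟩
  ecc v                          ∎
  where
  open ≤-Reasoning
  leaf : Vertex _ h
  leaf = replicate h zero , ≤-reflexive (length-replicate h)
height+depth≤ecc {suc (suc _)} {suc h} _ v@(b ∷ p , _) = begin
  suc h + suc (length p)
    ≡⟨ cong (λ n → suc n + suc (length p)) (sym (length-replicate h)) ⟩
  suc (length (replicate h zero)) + suc (length p)
    ≡⟨ sym (pathDist-diverging (replicate h zero) p (punchInᵢ≢i b zero)) ⟩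
  dist leaf v
    ≤⟨ dist≤ecc leaf v ⟩
  ecc v ∎
  where
  open ≤-Reasoning
  -- a leaf below a child of the root other than b, which exists since 2 ≤ k
  leaf : Vertex _ (suc h)
  leaf = punchIn b zero ∷ replicate h zero , s≤s (≤-reflexive (length-replicate h))

module _ {k h : ℕ} where

  update-isBroadcast : ∀ {f : Vertex k h → ℕ} {w c} → IsBroadcast f → c ≤ ecc w → IsBroadcast (f [ w ≔ c ])
  update-isBroadcast {w = w} isBroadcast c≤ecc y with y ≟ᵥ w
  ... | yes refl = ≤-trans c≤ecc (ecc≤diam y) , c≤ecc
  ... | no  _    = isBroadcast y

  clear-≤ : ∀ (f : Vertex k h → ℕ) v y → (f [ v ≔ 0 ]) y ≤ f y
  clear-≤ f v y with y ≟ᵥ v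
  ... | yes _ = z≤n
  ... | no  _ = ≤-refl

  isIndependent-antitone : ∀ {f g : Vertex k h → ℕ} → (∀ y → g y ≤ f y) → IsIndependent f → IsIndependent g
  isIndependent-antitone g≤f independent a b ga (gb , dab) =
    independent a b (≤-trans ga (g≤f a)) (≤-trans gb (g≤f b) , ≤-trans dab (g≤f b))

  broadcasters-apart : ∀ {f : Vertex k h → ℕ} → IsIndependent f →
    ∀ {x y} → Broadcasting f x → Broadcasting f y → x ≢ y → f y < dist x y
  broadcasters-apart independent {x} {y} fx fy x≢y = ≰⇒> λ d≤fy → x≢y (independent x y fx (fy , d≤fy))

  update-isIndependent : ∀ {f : Vertex k h → ℕ} {w c} → IsIndependent f →
    (∀ x → Broadcasting f x → x ≢ w → f x < dist w x × c < dist x w) → IsIndependent (f [ w ≔ c ])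
  update-isIndependent {w = w} independent apart a b ga (gb , dab) with a ≟ᵥ w | b ≟ᵥ w
  ... | yes refl | yes refl = refl
  ... | yes refl | no  b≢w  = contradiction dab (<⇒≱ (proj₁ (apart b gb b≢w)))
  ... | no  a≢w  | yes refl = contradiction dab (<⇒≱ (proj₂ (apart a ga a≢w)))
  ... | no  _    | no  _    = independent a b ga (gb , dab)

module _ {k h : ℕ} {f : Vertex k h → ℕ} where

  unheard-isIndepBroadcast : IsIndepBroadcast f → ∀ u → 1 ≤ ecc u → (∀ v → ¬ Hears f u v) →
                             IsIndepBroadcast (f [ u ≔ 1 ])
  unheard-isIndepBroadcast (isBroadcast , independent) u 1≤ecc unheard =
    update-isBroadcast isBroadcast 1≤ecc , update-isIndependent independent apart
    where
    apart : ∀ x → Broadcasting f x → x ≢ u → f x < dist u x × 1 < dist x u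
    apart x fx _ = fx<dist , ≤-<-trans fx (subst (f x <_) (pathDist-sym (proj₁ u) (proj₁ x)) fx<dist)
      where
      fx<dist : f x < dist u x
      fx<dist = ≰⇒> λ dist≤fx → unheard x (fx , dist≤fx)

  hears-some : IsMaxIndepBroadcast f → ∀ u → 1 ≤ ecc u → Σ (Vertex k h) (Hears f u)
  hears-some (indep , maximum) u 1≤ecc with any? (λ v → (0 <? f v) ×-dec (dist u v ≤? f v)) (allVertices k h)
  ... | yes heard = Any.satisfied heard
  ... | no  none  = contradiction (maximum g (unheard-isIndepBroadcast indep u 1≤ecc unheard)) (<⇒≱ gain)
    where
    g : Vertex k h → ℕ
    g = f [ u ≔ 1 ]

    unheard : ∀ v → ¬ Hears f u v
    unheard v hears = none (Any.map (λ v≡x → subst (Hears f u) v≡x hears) (∈-allVertices v))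

    fu≡0 : f u ≡ 0
    fu≡0 = n≤0⇒n≡0 (≮⇒≥ λ fu>0 → unheard u (fu>0 , subst (_≤ f u) (sym (pathDist-self (proj₁ u))) z≤n))

    gain : weight f < weight g
    gain = ≤-reflexive (begin
      suc (weight f)  ≡⟨ +-comm 1 (weight f) ⟩
      weight f + 1    ≡⟨ sym (weight-update f u 1) ⟩
      weight g + f u  ≡⟨ cong (weight g +_) fu≡0 ⟩
      weight g + 0    ≡⟨ +-identityʳ (weight g) ⟩
      weight g        ∎)
      where open ≡-Reasoning

module Exchange {k h : ℕ} (2≤k : 2 ≤ k) {f : Vertex k h → ℕ} (indep : IsIndepBroadcast f)
                (u v : Vertex k h) (leaf-u : IsLeaf u) (u-hears-v : Hears f u v) (v-inner : depth v < h) where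

  s t : ℕ
  s = f v
  t = h ∸ depth v

  extension : List (Fin k)
  extension = replicate t (fromℕ< (≤-trans (s≤s z≤n) 2≤k))

  depth-w : length (proj₁ v ++ extension) ≡ h
  depth-w = trans (length-++ (proj₁ v)) (trans (cong (depth v +_) (length-replicate t)) (m+[n∸m]≡n (proj₂ v)))

  w : Vertex k h
  w = proj₁ v ++ extension , ≤-reflexive depth-w

  w≢v : w ≢ v
  w≢v w≡v = <-irrefl (trans (sym (cong depth w≡v)) depth-w) v-inner

  dist-w-v : dist w v ≡ t
  dist-w-v = trans (pathDist-extension (proj₁ v) extension) (length-replicate t)

  t≤s : t ≤ s
  t≤s = ≤-trans (m≤n+o⇒m∸n≤o h (depth v) h≤depth+dist) (proj₂ u-hears-v)
    where
    h≤depth+dist : h ≤ depth v + dist u v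
    h≤depth+dist = subst (_≤ depth v + dist u v) leaf-u
      (≤-trans (length≤pathDist+length (proj₁ u) (proj₁ v)) (≤-reflexive (+-comm (dist u v) (depth v))))

  independent : IsIndependent f
  independent = proj₂ indep

  f-w≡0 : f w ≡ 0
  f-w≡0 = n≤0⇒n≡0 (≮⇒≥ λ fw>0 →
    <⇒≱ (broadcasters-apart independent fw>0 (proj₁ u-hears-v) w≢v) (subst (_≤ s) (sym dist-w-v) t≤s))

  dist-via-v : ∀ x → Broadcasting f x → x ≢ v → dist x w ≡ dist x v + t
  dist-via-v x fx x≢v with descendant-or-pathDist-++ (proj₁ x) (proj₁ v) extension
  ... | inj₁ x-below-v = contradiction
    (≤-trans (m+n≤o⇒m≤o∸n (dist x v) (≤-trans (≤-reflexive x-below-v) (proj₂ x))) t≤s)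
    (<⇒≱ (broadcasters-apart independent fx (proj₁ u-hears-v) x≢v))
  ... | inj₂ via-v     = trans via-v (cong (dist x v +_) (length-replicate t))

  f′ g : Vertex k h → ℕ
  f′ = f [ v ≔ 0 ]
  g  = f′ [ w ≔ s + t ]

  g-isIndepBroadcast : IsIndepBroadcast g
  g-isIndepBroadcast =
    update-isBroadcast (update-isBroadcast (proj₁ indep) z≤n) s+t≤ecc ,
    update-isIndependent (isIndependent-antitone (clear-≤ f v) independent) apart
    where
    s+t≤ecc : s + t ≤ ecc w
    s+t≤ecc = begin
      s + t                 ≤⟨ +-monoˡ-≤ t (≤-trans (proj₂ (proj₁ indep v)) (ecc≤height+depth v)) ⟩
      h + depth v + t       ≡⟨ +-assoc h (depth v) t ⟩
      h + (depth v + t)     ≡⟨ cong (h +_) (trans (m+[n∸m]≡n (proj₂ v)) (sym depth-w)) ⟩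
      h + depth w           ≤⟨ height+depth≤ecc 2≤k w ⟩
      ecc w                 ∎
      where open ≤-Reasoning

    apart : ∀ x → Broadcasting f′ x → x ≢ w → f′ x < dist w x × s + t < dist x w
    apart x f′x>0 _ with x ≟ᵥ v
    ... | yes refl = contradiction f′x>0 (<-irrefl refl)
    ... | no  x≢v  =
      ≤-trans (broadcasters-apart independent (proj₁ u-hears-v) f′x>0 (x≢v ∘ sym)) v-closer ,
      subst (s + t <_) (sym (dist-via-v x f′x>0 x≢v))
        (+-monoˡ-< t (broadcasters-apart independent f′x>0 (proj₁ u-hears-v) x≢v))
      where
      v-closer : dist v x ≤ dist w x
      v-closer = begin
        dist v x      ≡⟨ pathDist-sym (proj₁ v) (proj₁ x) ⟩
        dist x v      ≤⟨ m≤m+n (dist x v) t ⟩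
        dist x v + t  ≡⟨ sym (dist-via-v x f′x>0 x≢v) ⟩
        dist x w      ≡⟨ pathDist-sym (proj₁ x) (proj₁ w) ⟩
        dist w x      ∎
        where open ≤-Reasoning

  weight-g : weight g ≡ weight f + t
  weight-g = begin
    weight g                ≡⟨ sym (+-identityʳ (weight g)) ⟩
    weight g + 0            ≡⟨ cong (weight g +_) (sym (trans (update-other f 0 w≢v) f-w≡0)) ⟩
    weight g + f′ w         ≡⟨ weight-update f′ w (s + t) ⟩
    weight f′ + (s + t)     ≡⟨ sym (+-assoc (weight f′) s t) ⟩
    weight f′ + s + t       ≡⟨ cong (_+ t) (trans (weight-update f v 0) (+-identityʳ (weight f))) ⟩
    weight f + t            ∎
    where open ≡-Reasoning

heard-by-leaf-isLeaf : ∀ {k h} → 2 ≤ k → {f : Vertex k h → ℕ} → IsMaxIndepBroadcast f →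
                       ∀ u v → IsLeaf u → Hears f u v → IsLeaf v
heard-by-leaf-isLeaf {h = h} 2≤k {f} (indep , maximum) u v leaf-u u-hears-v with depth v Data.Nat.≟ h
... | yes leaf-v   = leaf-v
... | no  not-leaf = contradiction (maximum g g-isIndepBroadcast) (<⇒≱ gain)
  where
  v-inner : depth v < h
  v-inner = ≤∧≢⇒< (proj₂ v) not-leaf
  open Exchange 2≤k indep u v leaf-u u-hears-v v-inner
  gain : weight f < weight g
  gain = subst (weight f <_) (sym weight-g) (m<m+n (weight f) (m<n⇒0<n∸m v-inner))

mainTheorem13 : (k h : ℕ) → 2 ≤ k → 1 ≤ h → (f : Vertex k h → ℕ) → IsMaxIndepBroadcast f →
    (u : Vertex k h) → IsLeaf u → Σ (Vertex k h) (λ v → IsLeaf v × Hears f u v)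
mainTheorem13 k h 2≤k 1≤h f maximum u leaf-u =
  v , heard-by-leaf-isLeaf 2≤k maximum u v leaf-u u-hears-v , u-hears-v
  where
  1≤ecc : 1 ≤ ecc u
  1≤ecc = ≤-trans 1≤h (≤-trans (m≤m+n h (depth u)) (height+depth≤ecc 2≤k u))
  v : Vertex k h
  v = proj₁ (hears-some maximum u 1≤ecc)
  u-hears-v : Hears f u v
  u-hears-v = proj₂ (hears-some maximum u 1≤ecc)
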